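{- Let $G$ be a graph of girth at least $5$ and minimum degree $d\ge2$, and let $v$ be any vertex of $G$. Then there exist $d!$ distinct induced paths of order $d+2$ in $G$ having $v$ as an endvertex.
   Context: Graphs are finite and simple. The girth is the length of the shortest cycle. The order of a path is its number of vertices. -}

module Defs where

open import Data.Nat using (ℕ; zero; suc; _+_; _<_; _≤_; _≥_)
open import Data.Bool using (Bool; true; false; T)
open import Data.Fin using (Fin; toℕ)
open import Data.Vec.Functional using (Vector)
open import Data.List using (List; filter; length)
open import Data.List.Base using (allFin)
open import Data.Product using (Σ; _×_; _,_; ∃)
open import Relation.Binary.PropositionalEquality using (_≡_; _≢_)
open import Relation.Nullary using (¬_)
open import Data.Bool.Properties using (T?)
open import Function.Definitions using (Injective)

record Graph (n : ℕ) : Set where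
  field
    adj     : Fin n → Fin n → Bool
    sym     : ∀ u v → adj u v ≡ adj v u
    irrefl  : ∀ v → adj v v ≡ false

open Graph public

Adj : ∀ {n} → Graph n → Fin n → Fin n → Set
Adj G u v = T (adj G u v)

degree : ∀ {n} → Graph n → Fin n → ℕ
degree G v = length (filter (λ u → T? (adj G v u)) (allFin _))

MinDegree : ∀ {n} → Graph n → ℕ → Set
MinDegree {n} G d = (∀ v → d ≤ degree G v) × (∃ λ v → degree G v ≡ d)

IsCycle : ∀ {n} → Graph n → (k : ℕ) → Vector (Fin n) k → Set
IsCycle {n} G k c =
  (3 ≤ k) ×
  Injective _≡_ _≡_ c ×
  (∀ (i j : Fin k) → suc (toℕ i) ≡ toℕ j → Adj G (c i) (c j)) ×
  (∀ (i j : Fin k) → suc (toℕ i) ≡ k → toℕ j ≡ 0 → Adj G (c i) (c j))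

GirthAtLeast : ∀ {n} → Graph n → ℕ → Set
GirthAtLeast G g = ∀ k (c : Vector _ k) → k < g → ¬ IsCycle G k c

IsInducedPath : ∀ {n} → Graph n → (m : ℕ) → Vector (Fin n) m → Set
IsInducedPath {n} G m p =
  Injective _≡_ _≡_ p ×
  (∀ (i j : Fin m) → suc (toℕ i) ≡ toℕ j → Adj G (p i) (p j)) ×
  (∀ (i j : Fin m) → suc (toℕ i) < toℕ j → ¬ Adj G (p i) (p j))

module Submission where

-- Grow induced paths w ∷ … ∷ v backwards from the fixed vertex v, one new
-- end vertex at a time.  An end vertex u of an induced path q of order r+1
-- has at least d neighbours; a neighbour w fails to extend q only if it is
-- the second vertex of q or is adjacent to some vertex of q at position ≥ 3
-- (the vertices at positions 1 and 2 are excluded by the absence of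
-- triangles and 4-cycles).  Two distinct neighbours of u never share such a
-- vertex (again no 4-cycle), so at least d - (r - 1) extensions exist once
-- r ≥ 2; we use d, 1, d-1, d-2, …, 1 extensions in the successive steps.

open import Defs hiding (sym)
open import Data.Nat using (ℕ; _+_; _≤_; _!)
open import Data.Fin using (Fin; zero)
open import Data.Vec.Functional using (Vector)
open import Data.Product using (Σ; _×_)
open import Relation.Binary.PropositionalEquality using (_≡_)

open import Data.Nat using (zero; suc; _*_; _∸_; _<_; z≤n; s≤s)
open import Data.Nat.Properties
  using (suc-injective; +-suc; +-∸-assoc; m+n∸n≡m; ∸-monoˡ-≤; ∸-monoʳ-≤; ∸-monoʳ-<; <⇒≤; ≤-trans; *-assoc; *-comm; *-identityʳ; module ≤-Reasoning)
open import Data.Nat.Combinatorics.Base using (_P′_)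
open import Data.Nat.Combinatorics.Specification using (nP′n≡n!)
open import Data.Bool using (T)
open import Data.Bool.Properties using (T?)
open import Data.Fin using (suc; toℕ; fromℕ; inject≤; opposite; remQuot; combine; _≟_)
open import Data.Fin.Properties
  using (0≢1+n; toℕ-injective; toℕ-fromℕ; toℕ<n; inject≤-injective; injective⇒≤; combine-remQuot; opposite-prop; opposite-involutive; all?; any?)
open import Data.List using (List; filter; length)
open import Data.List.Base using (allFin)
open import Data.List.Relation.Unary.Unique.Propositional using (Unique)
open import Data.List.Relation.Unary.Unique.Propositional.Properties using (filter⁺; allFin⁺)
open import Data.List.Membership.Propositional using (_∈_)
open import Data.List.Membership.Propositional.Properties using (∈-filter⁻)
open import Data.Product using (_,_; proj₁; proj₂; ∃; uncurry)
open import Data.Empty using (⊥; ⊥-elim)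
open import Function using (_∘_)
open import Function.Definitions using (Injective)
open import Relation.Binary.PropositionalEquality
  using (_≢_; _≗_; refl; sym; trans; cong; subst; ≢-sym; module ≡-Reasoning)
open import Relation.Nullary using (¬_; yes; no; ¬?; _×-dec_)
open import Relation.Nullary.Decidable using (decidable-stable)
open import Relation.Unary using (Decidable)
open import Relation.Unary.Properties using (∁?)

module Counting {A : Set} where
  open import Data.List using ([]; _∷_; lookup)
  open import Data.List.Relation.Unary.All as All using ()
  open import Data.List.Relation.Unary.AllPairs using (_∷_)
  open import Data.List.Membership.Propositional.Properties using (∈-lookup)

  lookup-injective : ∀ {xs : List A} → Unique xs → Injective _≡_ _≡_ (lookup xs)
  lookup-injective {x ∷ xs} (x∉xs ∷ u) {zero}  {zero}  _ = refl
  lookup-injective {x ∷ xs} (x∉xs ∷ u) {zero}  {suc j} e = ⊥-elim (All.lookup x∉xs (∈-lookup j) e)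
  lookup-injective {x ∷ xs} (x∉xs ∷ u) {suc i} {zero}  e = ⊥-elim (All.lookup x∉xs (∈-lookup i) (sym e))
  lookup-injective {x ∷ xs} (x∉xs ∷ u) {suc i} {suc j} e = cong suc (lookup-injective u e)

  distinct-members : ∀ {xs : List A} {s} → Unique xs → s ≤ length xs →
    Σ (Fin s → A) λ f → Injective _≡_ _≡_ f × (∀ a → f a ∈ xs)
  distinct-members {xs} u s≤ =
    (λ a → lookup xs (inject≤ a s≤)) ,
    (λ e → inject≤-injective s≤ s≤ _ _ (lookup-injective u e)) ,
    (λ a → ∈-lookup (inject≤ a s≤))

  module _ {P : A → Set} (P? : Decidable P) where

    length-filter-split : ∀ xs → length (filter P? xs) + length (filter (∁? P?) xs) ≡ length xs
    length-filter-split []       = refl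
    length-filter-split (x ∷ xs) with P? x
    ... | yes _ = cong suc (length-filter-split xs)
    ... | no  _ = trans (+-suc _ _) (cong suc (length-filter-split xs))

    -- If every member of xs failing P has a witness in Fin t, and no
    -- witness serves two members, then at most t members fail P; hence
    -- any s ≤ length xs ∸ t distinct members satisfying P can be chosen.
    many-satisfy : ∀ {xs : List A} {t s} (W : A → Fin t → Set) → Unique xs →
      (∀ {x} → x ∈ xs → ¬ P x → ∃ (W x)) →
      (∀ {x y} i → x ∈ xs → y ∈ xs → W x i → W y i → x ≡ y) →
      s ≤ length xs ∸ t →
      Σ (Fin s → A) λ f → Injective _≡_ _≡_ f × (∀ a → f a ∈ xs × P (f a))
    many-satisfy {xs} {t} {s} W u witness unique s≤ =
      proj₁ chosen , proj₁ (proj₂ chosen) , λ a → ∈-filter⁻ P? (proj₂ (proj₂ chosen) a)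
      where
      failing = filter (∁? P?) xs
      failing-member : ∀ i → lookup failing i ∈ xs × ¬ P (lookup failing i)
      failing-member i = ∈-filter⁻ (∁? P?) (∈-lookup i)
      witness-of : Fin (length failing) → Fin t
      witness-of i = proj₁ (witness (proj₁ (failing-member i)) (proj₂ (failing-member i)))
      witness-of-injective : Injective _≡_ _≡_ witness-of
      witness-of-injective {i} {j} e = lookup-injective (filter⁺ (∁? P?) u)
        (unique _ (proj₁ (failing-member i)) (proj₁ (failing-member j))
          (subst (W _) e (proj₂ (witness _ _))) (proj₂ (witness _ _)))
      enough : s ≤ length (filter P? xs)
      enough = begin
        s                                               ≤⟨ s≤ ⟩
        length xs ∸ t                                   ≤⟨ ∸-monoʳ-≤ (length xs) (injective⇒≤ witness-of-injective) ⟩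
        length xs ∸ length failing                      ≡⟨ cong (_∸ length failing) (sym (length-filter-split xs)) ⟩
        length (filter P? xs) + length failing ∸ length failing ≡⟨ m+n∸n≡m _ (length failing) ⟩
        length (filter P? xs)                           ∎
        where open ≤-Reasoning
      chosen = distinct-members (filter⁺ P? u) enough

open Counting using (distinct-members; many-satisfy)
open import Data.Vec.Functional using (_∷_; [])

-- Number of leaves of a tree whose nodes at depth r have c r children.
leaves : (ℕ → ℕ) → ℕ → ℕ
leaves c zero    = 1
leaves c (suc r) = c r * leaves c r

remQuot-injective : ∀ {m} k {i j : Fin (m * k)} → remQuot {m} k i ≡ remQuot k j → i ≡ j
remQuot-injective {m} k {i} {j} e = begin
  i                                 ≡⟨ sym (combine-remQuot {m} k i) ⟩
  uncurry combine (remQuot {m} k i) ≡⟨ cong (uncurry combine) e ⟩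
  uncurry combine (remQuot {m} k j) ≡⟨ combine-remQuot {m} k j ⟩
  j                                 ∎
  where open ≡-Reasoning

-- Sequences are extended at the front.
module Tree {A : Set} (Ok : ∀ {r} → Vector A (suc r) → Set) (c : ℕ → ℕ)
  (extend : ∀ {r} (q : Vector A (suc r)) → Ok q →
    Σ (Fin (c r) → A) λ f → Injective _≡_ _≡_ f × (∀ a → Ok (f a ∷ q))) where

  Family : A → ℕ → ℕ → Set
  Family x K r = Σ (Fin K → Vector A (suc r)) λ F →
    (∀ i j → F i ≗ F j → i ≡ j) × (∀ i → Ok (F i) × F i (fromℕ r) ≡ x)

  next-layer : ∀ {x K r} → Family x K r → Family x (c r * K) (suc r)
  next-layer {x} {K} {r} (F , F-injective , F-ok) =
    (λ i → child (proj₁ (remQuot {c r} K i)) (proj₂ (remQuot {c r} K i))) ,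
    (λ i j e → remQuot-injective {c r} K (child-injective _ _ _ _ e)) ,
    (λ i → child-ok (proj₁ (remQuot {c r} K i)) (proj₂ (remQuot {c r} K i)))
    where
    children : ∀ b → Σ (Fin (c r) → A) λ f → Injective _≡_ _≡_ f × (∀ a → Ok (f a ∷ F b))
    children b = extend (F b) (proj₁ (F-ok b))
    child : Fin (c r) → Fin K → Vector A (suc (suc r))
    child a b = proj₁ (children b) a ∷ F b
    -- the tail identifies the parent, then the head identifies the child
    child-injective : ∀ a b a′ b′ → child a b ≗ child a′ b′ → (a , b) ≡ (a′ , b′)
    child-injective a b a′ b′ e with F-injective b b′ (e ∘ suc)
    ... | refl = cong (_, b) (proj₁ (proj₂ (children b)) (e zero))
    child-ok : ∀ a b → Ok (child a b) × child a b (fromℕ (suc r)) ≡ x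
    child-ok a b = proj₂ (proj₂ (children b)) a , proj₂ (F-ok b)

  grow : ∀ {x} → Ok (x ∷ []) → ∀ r → Family x (leaves c r) r
  grow ok zero    = (λ _ → _ ∷ []) , (λ { zero zero _ → refl }) , (λ _ → ok , refl)
  grow ok (suc r) = next-layer (grow ok r)

opposite-injective : ∀ {m} → Injective _≡_ _≡_ (opposite {m})
opposite-injective {_} {i} {j} e = begin
  i                       ≡⟨ sym (opposite-involutive i) ⟩
  opposite (opposite i)   ≡⟨ cong opposite e ⟩
  opposite (opposite j)   ≡⟨ opposite-involutive j ⟩
  j                       ∎
  where open ≡-Reasoning

reversed-≗ : ∀ {A : Set} {m} {p p′ : Vector A m} → p ∘ opposite ≗ p′ ∘ opposite → p ≗ p′
reversed-≗ {p = p} {p′} e k = subst (λ k′ → p k′ ≡ p′ k′) (opposite-involutive k) (e (opposite k))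

suc-opposite : ∀ {m} (j : Fin m) → suc (toℕ (opposite j)) ≡ m ∸ toℕ j
suc-opposite j = trans (cong suc (opposite-prop j)) (sym (+-∸-assoc 1 (toℕ<n j)))

opposite-step : ∀ {m} {i j : Fin m} → suc (toℕ i) ≡ toℕ j → suc (toℕ (opposite j)) ≡ toℕ (opposite i)
opposite-step {m} {i} {j} step = begin
  suc (toℕ (opposite j)) ≡⟨ suc-opposite j ⟩
  m ∸ toℕ j              ≡⟨ cong (m ∸_) (sym step) ⟩
  m ∸ suc (toℕ i)        ≡⟨ sym (opposite-prop i) ⟩
  toℕ (opposite i)       ∎
  where open ≡-Reasoning

opposite-gap : ∀ {m} {i j : Fin m} → suc (toℕ i) < toℕ j → suc (toℕ (opposite j)) < toℕ (opposite i)
opposite-gap {m} {i} {j} gap = begin-strict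
  suc (toℕ (opposite j)) ≡⟨ suc-opposite j ⟩
  m ∸ toℕ j              <⟨ ∸-monoʳ-< gap (<⇒≤ (toℕ<n j)) ⟩
  m ∸ suc (toℕ i)        ≡⟨ sym (opposite-prop i) ⟩
  toℕ (opposite i)       ∎
  where open ≤-Reasoning

module Paths {n : ℕ} (G : Graph n) where

  adj-sym : ∀ {u w} → Adj G u w → Adj G w u
  adj-sym {u} {w} = subst T (Graph.sym G u w)

  adj⇒≢ : ∀ {u w} → Adj G u w → u ≢ w
  adj⇒≢ {u} u~u refl = subst T (irrefl G u) u~u

  Distinct : ∀ {m} → Vector (Fin n) m → Set
  Distinct p = Injective _≡_ _≡_ p

  Consecutive : ∀ {m} → Vector (Fin n) m → Set
  Consecutive p = ∀ i j → suc (toℕ i) ≡ toℕ j → Adj G (p i) (p j)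

  Chordless : ∀ {m} → Vector (Fin n) m → Set
  Chordless p = ∀ i j → suc (toℕ i) < toℕ j → ¬ Adj G (p i) (p j)

  single-distinct : ∀ {x} → Distinct (x ∷ [])
  single-distinct {_} {zero} {zero} _ = refl

  single-consecutive : ∀ {x} → Consecutive (x ∷ [])
  single-consecutive zero zero ()

  single-induced : ∀ x → IsInducedPath G 1 (x ∷ [])
  single-induced x = single-distinct , single-consecutive , λ { zero zero () }

  ∷-distinct : ∀ {m w} {q : Vector (Fin n) m} → Distinct q → (∀ j → w ≢ q j) → Distinct (w ∷ q)
  ∷-distinct q-distinct fresh {zero}  {zero}  _ = refl
  ∷-distinct q-distinct fresh {zero}  {suc j} e = ⊥-elim (fresh j e)
  ∷-distinct q-distinct fresh {suc i} {zero}  e = ⊥-elim (fresh i (sym e))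
  ∷-distinct q-distinct fresh {suc i} {suc j} e = cong suc (q-distinct e)

  ∷-consecutive : ∀ {m w} {q : Vector (Fin n) (suc m)} → Consecutive q → Adj G w (q zero) →
    Consecutive (w ∷ q)
  ∷-consecutive q-cons w~q₀ zero    (suc zero)    _ = w~q₀
  ∷-consecutive q-cons w~q₀ (suc i) (suc j)       e = q-cons i j (suc-injective e)
  ∷-consecutive q-cons w~q₀ zero    zero          ()
  ∷-consecutive q-cons w~q₀ zero    (suc (suc j)) ()
  ∷-consecutive q-cons w~q₀ (suc i) zero          ()

  ∷-chordless : ∀ {m w} {q : Vector (Fin n) (suc m)} → Chordless q → (∀ j → ¬ Adj G w (q (suc j))) →
    Chordless (w ∷ q)
  ∷-chordless q-chordless far zero    (suc (suc j)) _         = far j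
  ∷-chordless q-chordless far (suc i) (suc j)       (s≤s lt) = q-chordless i j lt
  ∷-chordless q-chordless far zero    (suc zero)    (s≤s ())
  ∷-chordless q-chordless far zero    zero          ()
  ∷-chordless q-chordless far (suc i) zero          ()

  ∷-induced : ∀ {m w} {q : Vector (Fin n) (suc m)} → IsInducedPath G (suc m) q →
    (∀ j → w ≢ q j) → Adj G w (q zero) → (∀ j → ¬ Adj G w (q (suc j))) →
    IsInducedPath G (suc (suc m)) (w ∷ q)
  ∷-induced (q-distinct , q-cons , q-chordless) fresh w~q₀ far =
    ∷-distinct q-distinct fresh , ∷-consecutive q-cons w~q₀ , ∷-chordless q-chordless far

  closing : ∀ {k} (c : Vector (Fin n) (suc k)) → Adj G (c (fromℕ k)) (c zero) →
    ∀ i j → suc (toℕ i) ≡ suc k → toℕ j ≡ 0 → Adj G (c i) (c j)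
  closing {k} c last~first i j i-last j-first
    rewrite toℕ-injective {i = i} {j = fromℕ k} (trans (suc-injective i-last) (sym (toℕ-fromℕ k)))
          | toℕ-injective {i = j} {j = zero} j-first = last~first

  module _ (girth≥5 : GirthAtLeast G 5) where

    no-triangle : ∀ {a b c} → Adj G a b → Adj G b c → Adj G c a → ⊥
    no-triangle {a} {b} {c} a~b b~c c~a = girth≥5 3 (a ∷ b ∷ c ∷ []) (s≤s (s≤s (s≤s (s≤s z≤n))))
      ( s≤s (s≤s (s≤s z≤n))
      , ∷-distinct (∷-distinct single-distinct λ { zero → adj⇒≢ b~c })
                   (λ { zero → adj⇒≢ a~b ; (suc zero) → ≢-sym (adj⇒≢ c~a) })
      , ∷-consecutive (∷-consecutive single-consecutive b~c) a~b
      , closing (a ∷ b ∷ c ∷ []) c~a )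

    no-square : ∀ {a b c e} → a ≢ c → b ≢ e →
      Adj G a b → Adj G b c → Adj G c e → Adj G e a → ⊥
    no-square {a} {b} {c} {e} a≢c b≢e a~b b~c c~e e~a =
      girth≥5 4 (a ∷ b ∷ c ∷ e ∷ []) (s≤s (s≤s (s≤s (s≤s (s≤s z≤n)))))
      ( s≤s (s≤s (s≤s z≤n))
      , ∷-distinct (∷-distinct (∷-distinct single-distinct λ { zero → adj⇒≢ c~e })
                                (λ { zero → adj⇒≢ b~c ; (suc zero) → b≢e }))
                   (λ { zero → adj⇒≢ a~b ; (suc zero) → a≢c ; (suc (suc zero)) → ≢-sym (adj⇒≢ e~a) })
      , ∷-consecutive (∷-consecutive (∷-consecutive single-consecutive c~e) b~c) a~b
      , closing (a ∷ b ∷ c ∷ e ∷ []) e~a )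

    -- A neighbour w of the end q 0 of an induced
    -- path q, other than q 1 and nonadjacent to every q j with j ≥ 3,
    -- extends q: w is new since q 0 has no other neighbours on q, and w
    -- cannot be adjacent to q 1 (triangle) or q 2 (4-cycle).
    extend : ∀ {k w} {q : Vector (Fin n) (suc (suc k))} → IsInducedPath G (suc (suc k)) q →
      Adj G (q zero) w → w ≢ q (suc zero) → (∀ j → 3 ≤ toℕ j → ¬ Adj G w (q j)) →
      IsInducedPath G (suc (suc (suc k))) (w ∷ q)
    extend {w = w} {q = q} q-induced@(q-distinct , q-cons , q-chordless) q₀~w w≢q₁ far =
      ∷-induced q-induced fresh (adj-sym q₀~w) nonadjacent
      where
      fresh : ∀ j → w ≢ q j
      fresh zero          = ≢-sym (adj⇒≢ q₀~w)
      fresh (suc zero)    = w≢q₁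
      fresh (suc (suc j)) e = q-chordless zero (suc (suc j)) (s≤s (s≤s z≤n)) (subst (Adj G (q zero)) e q₀~w)
      nonadjacent : ∀ j → ¬ Adj G w (q (suc j))
      nonadjacent zero w~q₁ = no-triangle q₀~w w~q₁ (adj-sym (q-cons zero (suc zero) refl))
      nonadjacent (suc zero) w~q₂ =
        no-square (λ e → 0≢1+n (q-distinct e)) (≢-sym w≢q₁)
          (q-cons zero (suc zero) refl) (q-cons (suc zero) (suc (suc zero)) refl) (adj-sym w~q₂) (adj-sym q₀~w)
      nonadjacent (suc (suc j)) = far (suc (suc (suc j))) (s≤s (s≤s (s≤s z≤n)))

  reverse-induced : ∀ {m} {p : Vector (Fin n) m} → IsInducedPath G m p → IsInducedPath G m (p ∘ opposite)
  reverse-induced (p-distinct , p-cons , p-chordless) =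
    (λ e → opposite-injective (p-distinct e)) ,
    (λ i j step → adj-sym (p-cons _ _ (opposite-step step))) ,
    (λ i j gap i~j → p-chordless _ _ (opposite-gap gap) (adj-sym i~j))

-- The numbers of extensions of an induced path of order r+1 that we use:
-- d, then 1, then d-1, d-2, … .  (For r = 1 there are at least d-1, but
-- one suffices for the count d!.)
extensionCount : ℕ → ℕ → ℕ
extensionCount d zero          = d
extensionCount d (suc zero)    = 1
extensionCount d (suc (suc k)) = d ∸ suc k

module Extending {n : ℕ} (G : Graph n) (girth≥5 : GirthAtLeast G 5)
  (d : ℕ) (2≤d : 2 ≤ d) (deg : ∀ u → d ≤ degree G u) where

  open Paths G

  neighbours : Fin n → List (Fin n)
  neighbours u = filter (λ w → T? (adj G u w)) (allFin n)

  neighbours-unique : ∀ u → Unique (neighbours u)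
  neighbours-unique u = filter⁺ (λ w → T? (adj G u w)) (allFin⁺ n)

  ∈-neighbours : ∀ {u w} → w ∈ neighbours u → Adj G u w
  ∈-neighbours {u} w∈ = proj₂ (∈-filter⁻ (λ w → T? (adj G u w)) {xs = allFin n} w∈)

  Extensions : ∀ {r} → ℕ → Vector (Fin n) (suc r) → Set
  Extensions {r} s q =
    Σ (Fin s → Fin n) λ f → Injective _≡_ _≡_ f × (∀ a → IsInducedPath G (suc (suc r)) (f a ∷ q))

  as-extensions : ∀ {r s} {q : Vector (Fin n) (suc r)} {P : Fin n → Set} →
    (∀ {w} → Adj G (q zero) w → P w → IsInducedPath G (suc (suc r)) (w ∷ q)) →
    Σ (Fin s → Fin n) (λ f → Injective _≡_ _≡_ f × (∀ a → f a ∈ neighbours (q zero) × P (f a))) →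
    Extensions s q
  as-extensions extends (f , f-injective , chosen) =
    f , f-injective , λ a → extends (∈-neighbours (proj₁ (chosen a))) (proj₂ (chosen a))

  extensions : ∀ {r} (q : Vector (Fin n) (suc r)) → IsInducedPath G (suc r) q →
    Extensions (extensionCount d r) q
  extensions {zero} q q-induced with distinct-members (neighbours-unique (q zero)) (deg (q zero))
  ... | f , f-injective , f∈ = f , f-injective , λ a → first-edge (∈-neighbours (f∈ a))
    where
    first-edge : ∀ {w} → Adj G (q zero) w → IsInducedPath G 2 (w ∷ q)
    first-edge u~w = ∷-induced q-induced (λ { zero → ≢-sym (adj⇒≢ u~w) }) (adj-sym u~w) (λ ())
  -- all neighbours but q 1
  extensions {suc zero} q q-induced =
    as-extensions (λ u~w w≢q₁ → extend girth≥5 q-induced u~w w≢q₁ λ { zero () ; (suc zero) (s≤s ()) })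
      (many-satisfy {P = λ w → w ≢ q₁} (λ w → ¬? (w ≟ q₁)) {t = 1} (λ w _ → w ≡ q₁) (neighbours-unique u)
        (λ {w} _ ¬w≢q₁ → zero , decidable-stable (w ≟ q₁) ¬w≢q₁) (λ _ _ _ e e′ → trans e (sym e′))
        (∸-monoˡ-≤ 1 (≤-trans 2≤d (deg u))))
    where
    u = q zero
    q₁ = q (suc zero)
  -- the neighbours failing are q 1 and, for each j ≥ 3, at most one
  -- neighbour of q j
  extensions {suc (suc k)} q q-induced@(q-distinct , _) =
    as-extensions {P = Far} (λ u~w (w≢q₁ , far) → extend girth≥5 q-induced u~w w≢q₁ (far-from far))
      (many-satisfy Far? Witness (neighbours-unique u) witness witness-unique (∸-monoˡ-≤ (suc k) (deg u)))
    where
    u = q zero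
    q₁ = q (suc zero)
    Far : Fin n → Set
    Far w = w ≢ q₁ × (∀ i → ¬ Adj G w (q (suc (suc (suc i)))))
    Far? : Decidable Far
    Far? w = ¬? (w ≟ q₁) ×-dec all? (λ i → ¬? (T? (adj G w (q (suc (suc (suc i)))))))
    far-from : ∀ {w} → (∀ i → ¬ Adj G w (q (suc (suc (suc i))))) → ∀ j → 3 ≤ toℕ j → ¬ Adj G w (q j)
    far-from far (suc (suc (suc i))) _ = far i
    far-from far (suc (suc zero)) (s≤s (s≤s ()))
    far-from far (suc zero) (s≤s ())
    far-from far zero ()
    -- a neighbour fails because it is q 1 or because of a vertex q (3+i)
    Witness : Fin n → Fin (suc k) → Set
    Witness w zero    = w ≡ q₁
    Witness w (suc i) = Adj G w (q (suc (suc (suc i))))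
    witness : ∀ {w} → w ∈ neighbours u → ¬ Far w → ∃ (Witness w)
    witness {w} _ not-far with w ≟ q₁
    ... | yes w≡q₁ = zero , w≡q₁
    ... | no  w≢q₁ with any? (λ i → T? (adj G w (q (suc (suc (suc i))))))
    ...   | yes (i , w~q) = suc i , w~q
    ...   | no  none      = ⊥-elim (not-far (w≢q₁ , λ i w~q → none (i , w~q)))
    -- two neighbours of u adjacent to the same q (3+i) would form a 4-cycle
    witness-unique : ∀ {w w′} i → w ∈ neighbours u → w′ ∈ neighbours u → Witness w i → Witness w′ i → w ≡ w′
    witness-unique zero _ _ e e′ = trans e (sym e′)
    witness-unique {w} {w′} (suc i) w∈ w′∈ w~x w′~x with w ≟ w′
    ... | yes w≡w′ = w≡w′
    ... | no  w≢w′ = ⊥-elim (no-square girth≥5 (λ e → 0≢1+n (q-distinct e)) w≢w′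
                                (∈-neighbours w∈) w~x (adj-sym w′~x) (adj-sym (∈-neighbours w′∈)))

leaves-extensionCount : ∀ d₁ k → leaves (extensionCount (suc d₁)) (suc (suc k)) ≡ (d₁ P′ k) * suc d₁
leaves-extensionCount d₁ zero    = cong (1 *_) {x = suc d₁ * 1} (*-identityʳ (suc d₁))
leaves-extensionCount d₁ (suc k) = begin
  (d₁ ∸ k) * leaves (extensionCount (suc d₁)) (suc (suc k)) ≡⟨ cong ((d₁ ∸ k) *_) (leaves-extensionCount d₁ k) ⟩
  (d₁ ∸ k) * ((d₁ P′ k) * suc d₁)                          ≡⟨ sym (*-assoc (d₁ ∸ k) (d₁ P′ k) (suc d₁)) ⟩
  (d₁ P′ suc k) * suc d₁                                    ∎
  where open ≡-Reasoning

leaves-factorial : ∀ d₁ → leaves (extensionCount (suc d₁)) (suc (suc d₁)) ≡ suc d₁ !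
leaves-factorial d₁ = begin
  leaves (extensionCount (suc d₁)) (suc (suc d₁)) ≡⟨ leaves-extensionCount d₁ d₁ ⟩
  (d₁ P′ d₁) * suc d₁                             ≡⟨ cong (_* suc d₁) (nP′n≡n! d₁) ⟩
  d₁ ! * suc d₁                                   ≡⟨ *-comm (d₁ !) (suc d₁) ⟩
  suc d₁ !                                        ∎
  where open ≡-Reasoning

lemma16 : ∀ {n} (G : Graph n) (d : ℕ) → 2 ≤ d → GirthAtLeast G 5 → MinDegree G d →
    (v : Fin n) →
    Σ (Fin (d !) → Vector (Fin n) (2 + d)) λ P →
    (∀ i j → (∀ k → P i k ≡ P j k) → i ≡ j) ×
    (∀ i → IsInducedPath G (2 + d) (P i) × P i zero ≡ v)
lemma16 {n} G d@(suc (suc d₂)) 2≤d girth≥5 (deg , _) v =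
  subst PathsFrom (leaves-factorial (suc d₂)) (reversed (grow (single-induced v) (suc d)))
  where
  open Paths G
  open Extending G girth≥5 d 2≤d deg
  open Tree (λ {r} → IsInducedPath G (suc r)) (extensionCount d) extensions
  PathsFrom : ℕ → Set
  PathsFrom K = Σ (Fin K → Vector (Fin n) (2 + d)) λ P →
    (∀ i j → P i ≗ P j → i ≡ j) × (∀ i → IsInducedPath G (2 + d) (P i) × P i zero ≡ v)
  -- the grown paths end at v; read backwards they start there
  reversed : ∀ {K} → Family v K (suc d) → PathsFrom K
  reversed (F , F-injective , F-ok) =
    (λ i → F i ∘ opposite) ,
    (λ i j e → F-injective i j (reversed-≗ e)) ,
    (λ i → reverse-induced (proj₁ (F-ok i)) , proj₂ (F-ok i))
lemma16 G 1 (s≤s ()) _ _ _
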